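{- Let $p$ be a prime and let $r\ge2$ be an integer with $r\not\equiv 0\pmod p$. There exists an integer $e$ with $2\le e\le p-2$ for which Problem $A1(p,e,r)$ has a maximal solution if and only if $p-1$ is not squarefree.
   Context: For integers $d,e,r\ge2$, let $S(d,e,r)$ be the smallest set $S$ of positive integers such that (a) $r\in S$; (b) $n\in S$ whenever $n^e\in S$; (c) $(n+d)^e\in S$ whenever $n\in S$ ("smallest" meaning contained in every other such set). This is called the solution of Problem $A1(d,e,r)$; it is maximal if it equals $\{n\ge2: n\not\equiv0\pmod d\}$. -}

module Defs where

open import Data.Nat using (ℕ; suc; _+_; _*_; _^_; _≤_; _≥_)
open import Data.Nat.Divisibility using (_∣_)
open import Data.Product using (_×_)
open import Relation.Nullary using (¬_)
open import Relation.Binary.PropositionalEquality using (_≡_)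
open import Function.Bundles using (_⇔_)

-- The solution S(d,e,r) of Problem A1(d,e,r): the smallest set of positive
-- integers containing r, closed under n^e ∈ S ⇒ n ∈ S (n a positive integer),
-- and n ∈ S ⇒ (n+d)^e ∈ S.  Smallest set = inductively generated predicate.
data InS (d e r : ℕ) : ℕ → Set where
  base : InS d e r r
  root : ∀ {n} → 1 ≤ n → InS d e r (n ^ e) → InS d e r n
  step : ∀ {n} → InS d e r n → InS d e r ((n + d) ^ e)

Maximal : ℕ → ℕ → ℕ → Set
Maximal d e r = ∀ n → InS d e r n ⇔ (n ≥ 2 × ¬ (d ∣ n))

SquareFree : ℕ → Set
SquareFree n = ∀ m → m * m ∣ n → m ≡ 1

-- Every element of S(p,e,r) is at least 2 and prime to p, and S is closed under
-- n ↦ n + p (apply rule (c), then take an e-th root).  Put N = p - 1.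
--
-- If m² ∣ N with m ≥ 2, take e = N/m.  Then N ∣ e², so by Fermat x^(e²) ≡ 1 (mod p)
-- for every unit x.  Hence a = ((r+p)^e+p)^e ∈ S is ≡ 1, and for a unit n ≥ 2 the
-- power n^(e^J) is ≡ 1 and ≥ a for large J: it is reached from a by adding
-- multiples of p, and n is recovered by taking e-th roots.
--
-- If N is squarefree, let g = gcd(e, N) and t = N/g.  Then gcd(e, t) = 1, and
-- y = n^g satisfies y^t ≡ 1, so y ≡ 1 iff y^e ≡ 1.  Thus "n^g ≡ 1 (mod p)" is
-- preserved in both directions by both generating rules, so it holds on all of S
-- or on none of it.  A maximal S contains p + 1, so it would force x^g ≡ 1 for
-- every 0 < x < p, contradicting Σ_{x<p} x^g ≡ 0 (mod p), valid as 1 ≤ g ≤ p - 2.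
module Submission where

open import Defs
open import Data.Nat using (ℕ; _∸_; _≤_; _≥_)
open import Data.Nat.Divisibility using (_∣_)
open import Data.Nat.Primality using (Prime)
open import Data.Product using (Σ; _×_)
open import Relation.Nullary using (¬_)
open import Function.Bundles using (_⇔_)

open import Data.Nat.Base
open import Data.Nat.Properties
open import Data.Nat.Combinatorics using (_C_; nCn≡1; nC1≡n; nCk≡nC[n∸k]; nCk+nC[k+1]≡[n+1]C[k+1])
open import Data.Nat.Coprimality using (Coprime; prime⇒coprime; coprime-divisor; coprime-Bézout)
open import Data.Nat.Divisibility
open import Data.Nat.DivMod using (%-distribˡ-+; %-distribˡ-*; [m+n]%n≡m%n; %-remove-+ʳ; m≡m%n+[m/n]*n; m*n%n≡0)
open import Data.Nat.GCD using (gcd; gcd-greatest; gcd[m,n]∣m; gcd[m,n]∣n; gcd[m,n]≡0⇒n≡0; module Bézout)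
open import Data.Nat.Induction using (<-rec)
open import Data.Nat.Primality using (prime⇒nonZero; prime⇒nonTrivial; euclidsLemma)
open import Data.Nat.Solver using (module +-*-Solver)
open import Data.Fin.Base using (zero; suc; toℕ; fromℕ; inject₁)
open import Data.Fin.Properties using (toℕ-fromℕ; toℕ-inject₁; toℕ<n)
open import Data.Vec.Functional using (Vector; tail; init)
open import Data.Product using (∃-syntax; _,_)
open import Data.Sum using (inj₁; inj₂)
open import Function.Base using (_∘_)
open import Function.Bundles using (mk⇔; Equivalence)
open import Function.Properties.Equivalence using () renaming (refl to ⇔-refl; sym to ⇔-sym; trans to ⇔-trans)
open import Level using (0ℓ)
open import Relation.Binary.Bundles using (Setoid)
open import Relation.Binary.Structures using (IsEquivalence)
open import Relation.Binary.PropositionalEquality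
import Relation.Binary.Reasoning.Setoid as SetoidReasoning
open import Relation.Nullary using (Dec; contradiction; yes; no; ¬?)
open import Relation.Nullary.Decidable using (_×-dec_)
open import Algebra.Definitions.RawSemiring +-*-rawSemiring using () renaming (_×_ to _×ᴿ_; _^_ to _^ᴿ_)
open import Algebra.Properties.Semiring.Sum +-*-semiring
  using (sum; sum-syntax; sum⁺-syntax; sum-cong-≗; sum-init-last; sum-replicate-zero; ∑-distrib-+)
import Algebra.Properties.CommutativeSemiring.Binomial +-*-commutativeSemiring as Binomial
open +-*-Solver

[1+k]*[1+n]C[1+k]≡[1+n]*nCk : ∀ n k → suc k * (suc n C suc k) ≡ suc n * (n C k)
[1+k]*[1+n]C[1+k]≡[1+n]*nCk zero    zero    = refl
[1+k]*[1+n]C[1+k]≡[1+n]*nCk zero    (suc k) = *-zeroʳ (2 + k)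
[1+k]*[1+n]C[1+k]≡[1+n]*nCk (suc n) zero    =
  trans (+-identityʳ _) (trans (nC1≡n (2 + n)) (sym (*-identityʳ (2 + n))))
[1+k]*[1+n]C[1+k]≡[1+n]*nCk (suc n) (suc k) = begin
    suc (suc k) * (suc (suc n) C suc (suc k))
  ≡⟨ cong (suc (suc k) *_) (nCk+nC[k+1]≡[n+1]C[k+1] (suc n) (suc k)) ⟨
    suc (suc k) * (suc n C suc k + suc n C suc (suc k))
  ≡⟨ solve 3 (λ k a b → (con 2 :+ k) :* (a :+ b) := a :+ ((con 1 :+ k) :* a :+ (con 2 :+ k) :* b))
             refl k (suc n C suc k) (suc n C suc (suc k)) ⟩
    suc n C suc k + (suc k * (suc n C suc k) + suc (suc k) * (suc n C suc (suc k)))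
  ≡⟨ cong (suc n C suc k +_) (cong₂ _+_ ([1+k]*[1+n]C[1+k]≡[1+n]*nCk n k)
                                        ([1+k]*[1+n]C[1+k]≡[1+n]*nCk n (suc k))) ⟩
    suc n C suc k + (suc n * (n C k) + suc n * (n C suc k))
  ≡⟨ cong (suc n C suc k +_) (*-distribˡ-+ (suc n) (n C k) (n C suc k)) ⟨
    suc n C suc k + suc n * (n C k + n C suc k)
  ≡⟨ cong (λ c → suc n C suc k + suc n * c) (nCk+nC[k+1]≡[n+1]C[k+1] n k) ⟩
    suc (suc n) * (suc n C suc k)
  ∎
  where open ≡-Reasoning

[1+n]Cn≡1+n : ∀ n → suc n C n ≡ suc n
[1+n]Cn≡1+n n = trans (nCk≡nC[n∸k] (n≤1+n n)) (trans (cong (suc n C_) (m+n∸n≡m 1 n)) (nC1≡n (suc n)))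

prime∣pCk : ∀ {p k} → Prime p → 0 < k → k < p → p ∣ p C k
prime∣pCk {suc n} {suc k} p-prime _ k<p = coprime-divisor (prime⇒coprime p-prime k<p)
  (divides (n C k) (trans ([1+k]*[1+n]C[1+k]≡[1+n]*nCk n k) (*-comm (suc n) (n C k))))

-- The library's binomial theorem is stated with the generic semiring operations.

×ᴿ≡* : ∀ n x → n ×ᴿ x ≡ n * x
×ᴿ≡* zero    x = refl
×ᴿ≡* (suc n) x = cong (x +_) (×ᴿ≡* n x)

^ᴿ≡^ : ∀ x n → x ^ᴿ n ≡ x ^ n
^ᴿ≡^ x zero    = refl
^ᴿ≡^ x (suc n) = cong (x *_) (^ᴿ≡^ x n)

binomial : ∀ x n → (x + 1) ^ n ≡ ∑[ k ≤ n ] ((n C toℕ k) * x ^ toℕ k)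
binomial x n = begin
  (x + 1) ^ n                          ≡⟨ ^ᴿ≡^ (x + 1) n ⟨
  (x + 1) ^ᴿ n                         ≡⟨ Binomial.theorem n x 1 ⟩
  Binomial.binomialExpansion x 1 n     ≡⟨ sum-cong-≗ term ⟩
  ∑[ k ≤ n ] ((n C toℕ k) * x ^ toℕ k) ∎
  where
  open ≡-Reasoning
  term : ∀ k → Binomial.binomialTerm x 1 n k ≡ (n C toℕ k) * x ^ toℕ k
  term k = begin
    (n C i) ×ᴿ (x ^ᴿ i * 1 ^ᴿ (n ∸ i))  ≡⟨ ×ᴿ≡* (n C i) _ ⟩
    (n C i) * (x ^ᴿ i * 1 ^ᴿ (n ∸ i))   ≡⟨ cong ((n C i) *_) (cong₂ _*_ (^ᴿ≡^ x i) 1^ᴿ≡1) ⟩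
    (n C i) * (x ^ i * 1)               ≡⟨ cong ((n C i) *_) (*-identityʳ (x ^ i)) ⟩
    (n C i) * x ^ i                     ∎
    where
    i = toℕ k
    1^ᴿ≡1 : 1 ^ᴿ (n ∸ i) ≡ 1
    1^ᴿ≡1 = trans (^ᴿ≡^ 1 (n ∸ i)) (^-zeroˡ (n ∸ i))

∣-sum : ∀ {d n} (s : Vector ℕ n) → (∀ i → d ∣ s i) → d ∣ sum s
∣-sum {n = zero}  s d∣s = _ ∣0
∣-sum {n = suc n} s d∣s = ∣m∣n⇒∣m+n (d∣s zero) (∣-sum (tail s) (d∣s ∘ suc))

∣-^ : ∀ {d a} k .{{_ : NonZero k}} → d ∣ a → d ∣ a ^ k
∣-^ {a = a} (suc k) d∣a = ∣m⇒∣m*n (a ^ k) d∣a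

[m^n]^o≡[m^o]^n : ∀ m n o → (m ^ n) ^ o ≡ (m ^ o) ^ n
[m^n]^o≡[m^o]^n m n o = trans (^-*-assoc m n o) (trans (cong (m ^_) (*-comm n o)) (sym (^-*-assoc m o n)))

n<m^n : ∀ {m} → 2 ≤ m → ∀ n → n < m ^ n
n<m^n 2≤m zero    = z<s
n<m^n {m} 2≤m (suc n) = begin
  suc (suc n)    ≤⟨ +-mono-≤ (m^n>0 m {{>-nonZero (<-trans z<s 2≤m)}} n) (n<m^n 2≤m n) ⟩
  m ^ n + m ^ n  ≡⟨ cong (m ^ n +_) (+-identityʳ (m ^ n)) ⟨
  2 * m ^ n      ≤⟨ *-monoˡ-≤ (m ^ n) 2≤m ⟩
  m * m ^ n      ∎
  where open ≤-Reasoning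

infix 4 _≡_mod_
record _≡_mod_ (a b m : ℕ) .{{_ : NonZero m}} : Set where
  constructor mk
  field residue : a % m ≡ b % m

module _ {m : ℕ} .{{_ : NonZero m}} where

  ≡mod-isEquivalence : IsEquivalence (λ a b → a ≡ b mod m)
  ≡mod-isEquivalence = record
    { refl  = mk refl
    ; sym   = λ (mk e) → mk (sym e)
    ; trans = λ (mk e) (mk e′) → mk (trans e e′)
    }

  ≡mod-setoid : Setoid 0ℓ 0ℓ
  ≡mod-setoid = record { isEquivalence = ≡mod-isEquivalence }

  open IsEquivalence ≡mod-isEquivalence public
    using () renaming (refl to ≡mod-refl; sym to ≡mod-sym; trans to ≡mod-trans)

  ≡⇒≡mod : ∀ {a b} → a ≡ b → a ≡ b mod m
  ≡⇒≡mod refl = ≡mod-refl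

  +-cong-mod : ∀ {a b c d} → a ≡ b mod m → c ≡ d mod m → a + c ≡ b + d mod m
  +-cong-mod {a} {b} {c} {d} (mk e) (mk e′) = mk (begin
    (a + c) % m          ≡⟨ %-distribˡ-+ a c m ⟩
    (a % m + c % m) % m  ≡⟨ cong₂ (λ u v → (u + v) % m) e e′ ⟩
    (b % m + d % m) % m  ≡⟨ %-distribˡ-+ b d m ⟨
    (b + d) % m          ∎)
    where open ≡-Reasoning

  *-cong-mod : ∀ {a b c d} → a ≡ b mod m → c ≡ d mod m → a * c ≡ b * d mod m
  *-cong-mod {a} {b} {c} {d} (mk e) (mk e′) = mk (begin
    (a * c) % m            ≡⟨ %-distribˡ-* a c m ⟩
    (a % m * (c % m)) % m  ≡⟨ cong₂ (λ u v → (u * v) % m) e e′ ⟩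
    (b % m * (d % m)) % m  ≡⟨ %-distribˡ-* b d m ⟨
    (b * d) % m            ∎)
    where open ≡-Reasoning

  ^-congˡ-mod : ∀ {a b} n → a ≡ b mod m → a ^ n ≡ b ^ n mod m
  ^-congˡ-mod zero    _   = ≡mod-refl
  ^-congˡ-mod (suc n) a≡b = *-cong-mod a≡b (^-congˡ-mod n a≡b)

  +-mod-identityʳ : ∀ a → a + m ≡ a mod m
  +-mod-identityʳ a = mk ([m+n]%n≡m%n a m)

  ∣⇒≡0-mod : ∀ {a} → m ∣ a → a ≡ 0 mod m
  ∣⇒≡0-mod {a} m∣a = mk (trans (n∣m⇒m%n≡0 a m m∣a) (sym (m*n%n≡0 0 m)))

  ≡0-mod⇒∣ : ∀ {a} → a ≡ 0 mod m → m ∣ a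
  ≡0-mod⇒∣ {a} (mk e) = m%n≡0⇒n∣m a m (trans e (m*n%n≡0 0 m))

  ≡mod⇒∣∸ : ∀ {a b} → a ≡ b mod m → m ∣ b ∸ a
  ≡mod⇒∣∸ {a} {b} (mk e) = divides (b / m ∸ a / m) (begin
    b ∸ a                                      ≡⟨ cong₂ _∸_ (m≡m%n+[m/n]*n b m) (m≡m%n+[m/n]*n a m) ⟩
    (b % m + b / m * m) ∸ (a % m + a / m * m)  ≡⟨ cong (λ u → (b % m + b / m * m) ∸ (u + a / m * m)) e ⟩
    (b % m + b / m * m) ∸ (b % m + a / m * m)  ≡⟨ [m+n]∸[m+o]≡n∸o (b % m) _ _ ⟩
    b / m * m ∸ a / m * m                      ≡⟨ *-distribʳ-∸ m (b / m) (a / m) ⟨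
    (b / m ∸ a / m) * m                        ∎)
    where open ≡-Reasoning

  ∣∸⇒≡mod : ∀ {a b} → a ≤ b → m ∣ b ∸ a → a ≡ b mod m
  ∣∸⇒≡mod {a} {b} a≤b m∣b∸a =
    mk (sym (trans (cong (_% m) (sym (m+[n∸m]≡n a≤b))) (%-remove-+ʳ a m∣b∸a)))

  sum≡ends-mod : ∀ n .{{_ : NonZero n}} (s : Vector ℕ (suc n)) →
                 (∀ i → 0 < toℕ i → toℕ i < n → m ∣ s i) → sum s ≡ s zero + s (fromℕ n) mod m
  sum≡ends-mod (suc n) s m∣interior = +-cong-mod (≡mod-refl {s zero}) (begin
    sum (tail s)                             ≡⟨ sum-init-last (tail s) ⟩
    sum (init (tail s)) + s (fromℕ (suc n))  ≈⟨ +-cong-mod (∣⇒≡0-mod (∣-sum _ m∣middle)) ≡mod-refl ⟩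
    s (fromℕ (suc n))                        ∎)
    where
    open SetoidReasoning ≡mod-setoid
    m∣middle : ∀ i → m ∣ s (suc (inject₁ i))
    m∣middle i = m∣interior _ z<s (s<s (subst (_< n) (sym (toℕ-inject₁ i)) (toℕ<n i)))

  ^-*-≡1-mod : ∀ {y} a b → y ^ a ≡ 1 mod m → y ^ (b * a) ≡ 1 mod m
  ^-*-≡1-mod {y} a b yᵃ≡1 = begin
    y ^ (b * a)  ≡⟨ cong (y ^_) (*-comm b a) ⟩
    y ^ (a * b)  ≡⟨ ^-*-assoc y a b ⟨
    (y ^ a) ^ b  ≈⟨ ^-congˡ-mod b yᵃ≡1 ⟩
    1 ^ b        ≡⟨ ^-zeroˡ b ⟩
    1            ∎
    where open SetoidReasoning ≡mod-setoid

  ^≡1∧^suc≡1⇒≡1-mod : ∀ {y} c → y ^ c ≡ 1 mod m → y ^ suc c ≡ 1 mod m → y ≡ 1 mod m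
  ^≡1∧^suc≡1⇒≡1-mod {y} c yᶜ≡1 y¹⁺ᶜ≡1 = begin
    y          ≡⟨ *-identityʳ y ⟨
    y * 1      ≈⟨ *-cong-mod (≡mod-refl {y}) (≡mod-sym yᶜ≡1) ⟩
    y * y ^ c  ≈⟨ y¹⁺ᶜ≡1 ⟩
    1          ∎
    where open SetoidReasoning ≡mod-setoid

  ^≡1-coprime : ∀ {y a b} → Coprime a b → y ^ a ≡ 1 mod m → y ^ b ≡ 1 mod m → y ≡ 1 mod m
  ^≡1-coprime {y} {a} {b} a⊥b yᵃ≡1 yᵇ≡1 with coprime-Bézout a⊥b
  ... | Bézout.+- u v 1+vb≡ua = ^≡1∧^suc≡1⇒≡1-mod (v * b) (^-*-≡1-mod b v yᵇ≡1)
          (subst (λ k → y ^ k ≡ 1 mod m) (sym 1+vb≡ua) (^-*-≡1-mod a u yᵃ≡1))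
  ... | Bézout.-+ u v 1+ua≡vb = ^≡1∧^suc≡1⇒≡1-mod (u * a) (^-*-≡1-mod a u yᵃ≡1)
          (subst (λ k → y ^ k ≡ 1 mod m) (sym 1+ua≡vb) (^-*-≡1-mod b v yᵇ≡1))

powerSum : ℕ → ℕ → ℕ
powerSum i n = ∑[ x < n ] (toℕ x ^ i)

powerSum-suc : ∀ i n → powerSum i (suc n) ≡ powerSum i n + n ^ i
powerSum-suc i n = trans (sum-init-last {n} (λ x → toℕ x ^ i))
  (cong₂ _+_ (sum-cong-≗ {n} (cong (_^ i) ∘ toℕ-inject₁)) (cong (_^ i) (toℕ-fromℕ n)))

^≡∑powerSum : ∀ j n → n ^ suc j ≡ ∑[ i ≤ j ] ((suc j C toℕ i) * powerSum (toℕ i) n)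
^≡∑powerSum j zero =
  sym (trans (sum-cong-≗ {suc j} (λ i → *-zeroʳ (suc j C toℕ i))) (sum-replicate-zero (suc j)))
^≡∑powerSum j (suc n) = begin
  suc n ^ suc j                                        ≡⟨ cong (_^ suc j) (+-comm 1 n) ⟩
  (n + 1) ^ suc j                                      ≡⟨ binomial n (suc j) ⟩
  ∑[ k ≤ suc j ] t (toℕ k)                             ≡⟨ sum-init-last {suc j} (t ∘ toℕ) ⟩
  ∑[ k ≤ j ] t (toℕ (inject₁ k)) + t (toℕ (fromℕ (suc j)))
    ≡⟨ cong₂ _+_ (sum-cong-≗ {suc j} (cong t ∘ toℕ-inject₁)) (cong t (toℕ-fromℕ (suc j))) ⟩
  ∑[ k ≤ j ] t (toℕ k) + t (suc j)                     ≡⟨ +-comm _ (t (suc j)) ⟩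
  t (suc j) + ∑[ k ≤ j ] t (toℕ k)
    ≡⟨ cong (_+ ∑[ k ≤ j ] t (toℕ k)) (trans t[1+j]≡nʲ⁺¹ (^≡∑powerSum j n)) ⟩
  ∑[ k ≤ j ] s n (toℕ k) + ∑[ k ≤ j ] t (toℕ k)        ≡⟨ ∑-distrib-+ {suc j} (s n ∘ toℕ) (t ∘ toℕ) ⟨
  ∑[ k ≤ j ] (s n (toℕ k) + t (toℕ k))                 ≡⟨ sum-cong-≗ {suc j} (s-suc ∘ toℕ) ⟩
  ∑[ k ≤ j ] s (suc n) (toℕ k)                         ∎
  where
  open ≡-Reasoning
  t : ℕ → ℕ
  t i = (suc j C i) * n ^ i
  s : ℕ → ℕ → ℕ
  s m i = (suc j C i) * powerSum i m
  t[1+j]≡nʲ⁺¹ : t (suc j) ≡ n ^ suc j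
  t[1+j]≡nʲ⁺¹ = trans (cong (_* n ^ suc j) (nCn≡1 (suc j))) (*-identityˡ (n ^ suc j))
  s-suc : ∀ i → s n i + t i ≡ s (suc n) i
  s-suc i = trans (sym (*-distribˡ-+ (suc j C i) (powerSum i n) (n ^ i)))
                  (cong ((suc j C i) *_) (sym (powerSum-suc i n)))

¬squareFree⇒square∣ : ∀ {n} .{{_ : NonZero n}} → ¬ SquareFree n → ∃[ m ] 2 ≤ m × m * m ∣ n
¬squareFree⇒square∣ {n} ¬sf with anyUpTo? (λ m → (m * m ∣? n) ×-dec ¬? (m ≟ 1)) (suc n)
... | yes (m , _ , m²∣n , m≢1) = m , 2≤ m m²∣n m≢1 , m²∣n
  where
  2≤ : ∀ m → m * m ∣ n → m ≢ 1 → 2 ≤ m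
  2≤ 0      0∣n _   = contradiction (0∣⇒≡0 0∣n) (≢-nonZero⁻¹ n)
  2≤ 1      _   1≢1 = contradiction refl 1≢1
  2≤ (2+ _) _   _   = s≤s (s≤s z≤n)
... | no no-square = contradiction squareFree ¬sf
  where
  m≤n : ∀ m → m * m ∣ n → m ≤ n
  m≤n zero    _    = z≤n
  m≤n (suc m) m²∣n = ≤-trans (m≤m*n (suc m) (suc m)) (∣⇒≤ m²∣n)
  squareFree : SquareFree n
  squareFree m m²∣n with m ≟ 1
  ... | yes m≡1 = m≡1
  ... | no  m≢1 = contradiction (m , s≤s (m≤n m m²∣n) , m²∣n , m≢1) no-square

squareFree⇒coprime-cofactor : ∀ {e n t} → SquareFree n → n ≡ t * gcd e n → Coprime e t
squareFree⇒coprime-cofactor {e} {n} {t} sf n≡t*g {d} (d∣e , d∣t) =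
  sf d (subst (d * d ∣_) (sym n≡t*g) (*-pres-∣ d∣t (gcd-greatest d∣e d∣n)))
  where
  d∣n : d ∣ n
  d∣n = subst (d ∣_) (sym n≡t*g) (∣m⇒∣m*n (gcd e n) d∣t)

module _ {d e r : ℕ} where

  InS⇒2≤ : 1 ≤ e → 2 ≤ r → ∀ {n} → InS d e r n → 2 ≤ n
  InS⇒2≤ _   2≤r base              = 2≤r
  InS⇒2≤ 1≤e 2≤r (root {1} _ s)    = subst (2 ≤_) (^-zeroˡ e) (InS⇒2≤ 1≤e 2≤r s)
  InS⇒2≤ _   _   (root {2+ _} _ _) = s≤s (s≤s z≤n)
  InS⇒2≤ 1≤e 2≤r (step {n} s) = begin
    2            ≤⟨ 2≤n ⟩
    n            ≤⟨ m≤m+n n d ⟩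
    n + d        ≡⟨ *-identityʳ (n + d) ⟨
    (n + d) ^ 1  ≤⟨ ^-monoʳ-≤ (n + d) {{>-nonZero (<-≤-trans z<s (≤-trans 2≤n (m≤m+n n d)))}} 1≤e ⟩
    (n + d) ^ e  ∎
    where
    open ≤-Reasoning
    2≤n = InS⇒2≤ 1≤e 2≤r s

  InS-invariant : (Q : ℕ → Set) → (∀ n → Q (n ^ e) ⇔ Q n) → (∀ n → Q (n + d) ⇔ Q n) →
                  ∀ {n} → InS d e r n → Q n ⇔ Q r
  InS-invariant Q Q-pow Q-shift base           = ⇔-refl
  InS-invariant Q Q-pow Q-shift (root {n} _ s) = ⇔-trans (⇔-sym (Q-pow n)) (InS-invariant Q Q-pow Q-shift s)
  InS-invariant Q Q-pow Q-shift (step {n} s)   =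
    ⇔-trans (Q-pow (n + d)) (⇔-trans (Q-shift n) (InS-invariant Q Q-pow Q-shift s))

  InS-root^ : ∀ J {x} → 1 ≤ x → InS d e r (x ^ (e ^ J)) → InS d e r x
  InS-root^ zero    {x} _   s = subst (InS d e r) (*-identityʳ x) s
  InS-root^ (suc J) {x} 1≤x s =
    root 1≤x (InS-root^ J (m^n>0 x {{>-nonZero 1≤x}} e) (subst (InS d e r) (sym (^-*-assoc x e (e ^ J))) s))

  module _ .{{_ : NonZero d}} where

    InS-+*d : ∀ {a} → InS d e r a → ∀ j → InS d e r (a + j * d)
    InS-+*d {a} s zero    = subst (InS d e r) (sym (+-identityʳ a)) s
    InS-+*d {a} s (suc j) =
      subst (InS d e r) a+jd+d≡a+[1+j]d (root (<-≤-trans (>-nonZero⁻¹ d) (m≤n+m d _)) (step (InS-+*d s j)))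
      where
      a+jd+d≡a+[1+j]d : a + j * d + d ≡ a + suc j * d
      a+jd+d≡a+[1+j]d = trans (+-assoc a (j * d) d) (cong (a +_) (+-comm (j * d) d))

    InS-≡mod-upward : ∀ {a b} → InS d e r a → a ≤ b → a ≡ b mod d → InS d e r b
    InS-≡mod-upward {a} {b} s a≤b a≡b with ≡mod⇒∣∸ a≡b
    ... | divides j b∸a≡jd = subst (InS d e r) (trans (cong (a +_) (sym b∸a≡jd)) (m+[n∸m]≡n a≤b)) (InS-+*d s j)

    InS-complete : 2 ≤ e → ¬ d ∣ r → (∀ {x} → ¬ d ∣ x → x ^ (e * e) ≡ 1 mod d) →
                   ∀ {n} → 2 ≤ n → ¬ d ∣ n → InS d e r n
    InS-complete 2≤e d∤r e²-kills {n} 2≤n d∤n =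
      InS-root^ (2 + a) (<-trans z<s 2≤n) (InS-≡mod-upward (step (step base)) a≤nᴱ a≡nᴱ)
      where
      a E : ℕ
      a = ((r + d) ^ e + d) ^ e
      E = e ^ (2 + a)
      a≡nᴱ : a ≡ n ^ E mod d
      a≡nᴱ = begin
        ((r + d) ^ e + d) ^ e  ≈⟨ ^-congˡ-mod e (+-mod-identityʳ ((r + d) ^ e)) ⟩
        ((r + d) ^ e) ^ e      ≈⟨ ^-congˡ-mod e (^-congˡ-mod e (+-mod-identityʳ r)) ⟩
        (r ^ e) ^ e            ≡⟨ ^-*-assoc r e e ⟩
        r ^ (e * e)            ≈⟨ e²-kills d∤r ⟩
        1                      ≈⟨ ^-*-≡1-mod (e * e) (e ^ a) (e²-kills d∤n) ⟨
        n ^ (e ^ a * (e * e))  ≡⟨ cong (n ^_) (trans (*-comm (e ^ a) (e * e)) (*-assoc e e (e ^ a))) ⟩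
        n ^ E                  ∎
        where open SetoidReasoning (≡mod-setoid {d})
      a≤nᴱ : a ≤ n ^ E
      a≤nᴱ = begin
        a      ≤⟨ m≤n+m a 2 ⟩
        2 + a  ≤⟨ <⇒≤ (n<m^n 2≤e (2 + a)) ⟩
        E      ≤⟨ <⇒≤ (n<m^n ≤-refl E) ⟩
        2 ^ E  ≤⟨ ^-monoˡ-≤ E 2≤n ⟩
        n ^ E  ∎
        where open ≤-Reasoning

module _ {p : ℕ} (p-prime : Prime p) where

  private
    instance
      p≢0 : NonZero p
      p≢0 = prime⇒nonZero p-prime

    1<p : 1 < p
    1<p = nonTrivial⇒n>1 p {{prime⇒nonTrivial p-prime}}

    N : ℕ
    N = p ∸ 1

    instance
      N≢0 : NonZero N
      N≢0 = >-nonZero (m<n⇒0<n∸m 1<p)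

    gcd[e,N]≢0 : ∀ e → NonZero (gcd e N)
    gcd[e,N]≢0 e = ≢-nonZero (≢-nonZero⁻¹ N ∘ gcd[m,n]≡0⇒n≡0 e)

  0<x<p⇒p∤x : ∀ {x} → 0 < x → x < p → ¬ p ∣ x
  0<x<p⇒p∤x {suc x} _ x<p p∣x = <⇒≱ x<p (∣⇒≤ p∣x)

  1≢0-mod : ¬ 1 ≡ 0 mod p
  1≢0-mod 1≡0 = 0<x<p⇒p∤x z<s 1<p (≡0-mod⇒∣ 1≡0)

  ∣^⇒∣ : ∀ {a} k → p ∣ a ^ k → p ∣ a
  ∣^⇒∣ zero        p∣1 = contradiction p∣1 (0<x<p⇒p∤x z<s 1<p)
  ∣^⇒∣ {a} (suc k) p∣a*aᵏ with euclidsLemma a (a ^ k) p-prime p∣a*aᵏ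
  ... | inj₁ p∣a  = p∣a
  ... | inj₂ p∣aᵏ = ∣^⇒∣ k p∣aᵏ

  *-cancelˡ-∣∸ : ∀ {x a b} → ¬ p ∣ x → x * a ≡ x * b mod p → p ∣ b ∸ a
  *-cancelˡ-∣∸ {x} {a} {b} p∤x xa≡xb
    with euclidsLemma x (b ∸ a) p-prime (subst (p ∣_) (sym (*-distribˡ-∸ x b a)) (≡mod⇒∣∸ xa≡xb))
  ... | inj₁ p∣x   = contradiction p∣x p∤x
  ... | inj₂ p∣b∸a = p∣b∸a

  *-cancelˡ-mod : ∀ {x u v} → ¬ p ∣ x → x * u ≡ x * v mod p → u ≡ v mod p
  *-cancelˡ-mod {x} {u} {v} p∤x xu≡xv with ≤-total u v
  ... | inj₁ u≤v = ∣∸⇒≡mod u≤v (*-cancelˡ-∣∸ p∤x xu≡xv)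
  ... | inj₂ v≤u = ≡mod-sym (∣∸⇒≡mod v≤u (*-cancelˡ-∣∸ p∤x (≡mod-sym xu≡xv)))

  frobenius : ∀ x → (x + 1) ^ p ≡ 1 + x ^ p mod p
  frobenius x = begin
    (x + 1) ^ p                                ≡⟨ binomial x p ⟩
    ∑[ k ≤ p ] t (toℕ k)                       ≈⟨ sum≡ends-mod p (t ∘ toℕ) p∣middle ⟩
    1 + t (toℕ (fromℕ p))                      ≡⟨ cong (λ k → 1 + t k) (toℕ-fromℕ p) ⟩
    1 + (p C p) * x ^ p                        ≡⟨ cong (λ c → 1 + c * x ^ p) (nCn≡1 p) ⟩
    1 + 1 * x ^ p                              ≡⟨ cong (1 +_) (*-identityˡ (x ^ p)) ⟩
    1 + x ^ p                                  ∎
    where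
    open SetoidReasoning (≡mod-setoid {p})
    t : ℕ → ℕ
    t k = (p C k) * x ^ k
    p∣middle : ∀ k → 0 < toℕ k → toℕ k < p → p ∣ t (toℕ k)
    p∣middle k 0<k k<p = ∣m⇒∣m*n (x ^ toℕ k) (prime∣pCk p-prime 0<k k<p)

  ^p≡-mod : ∀ x → x ^ p ≡ x mod p
  ^p≡-mod zero    = ≡⇒≡mod (subst (λ n → 0 ^ n ≡ 0) (suc-pred p) refl)
  ^p≡-mod (suc x) = begin
    suc x ^ p    ≡⟨ cong (_^ p) (+-comm 1 x) ⟩
    (x + 1) ^ p  ≈⟨ frobenius x ⟩
    1 + x ^ p    ≈⟨ +-cong-mod (≡mod-refl {x = 1}) (^p≡-mod x) ⟩
    suc x        ∎
    where open SetoidReasoning (≡mod-setoid {p})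

  fermat : ∀ {x} → ¬ p ∣ x → x ^ N ≡ 1 mod p
  fermat {x} p∤x = *-cancelˡ-mod p∤x (begin
    x * x ^ N  ≡⟨ cong (x ^_) (suc-pred p) ⟩
    x ^ p      ≈⟨ ^p≡-mod x ⟩
    x          ≡⟨ *-identityʳ x ⟨
    x * 1      ∎)
    where open SetoidReasoning (≡mod-setoid {p})

  -- Expanding p^(i+1) by ^≡∑powerSum gives p ∣ (i+1) · powerSum i p once the
  -- lower power sums are known to be divisible by p; and i + 1 < p is a unit.
  p∣powerSum : ∀ i → suc i < p → p ∣ powerSum i p
  p∣powerSum = <-rec (λ i → suc i < p → p ∣ powerSum i p) from-lower
    where
    from-lower : ∀ i → (∀ {j} → j < i → suc j < p → p ∣ powerSum j p) → suc i < p → p ∣ powerSum i p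
    from-lower i p∣lower 1+i<p = coprime-divisor (prime⇒coprime p-prime 1+i<p) p∣top
      where
      s : ℕ → ℕ
      s j = (suc i C j) * powerSum j p
      p∣lower-terms : ∀ k → p ∣ s (toℕ (inject₁ k))
      p∣lower-terms k = ∣n⇒∣m*n (suc i C toℕ (inject₁ k)) (p∣lower j<i (<-trans (s<s j<i) 1+i<p))
        where j<i = subst (_< i) (sym (toℕ-inject₁ k)) (toℕ<n k)
      lower : ℕ
      lower = ∑[ k < i ] s (toℕ (inject₁ k))
      expansion : p ^ suc i ≡ lower + suc i * powerSum i p
      expansion = begin
        p ^ suc i                     ≡⟨ ^≡∑powerSum i p ⟩
        ∑[ k ≤ i ] s (toℕ k)          ≡⟨ sum-init-last {i} (s ∘ toℕ) ⟩
        lower + s (toℕ (fromℕ i))     ≡⟨ cong (λ j → lower + s j) (toℕ-fromℕ i) ⟩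
        lower + s i                   ≡⟨ cong (λ c → lower + c * powerSum i p) ([1+n]Cn≡1+n i) ⟩
        lower + suc i * powerSum i p  ∎
        where open ≡-Reasoning
      p∣top : p ∣ suc i * powerSum i p
      p∣top = ∣m+n∣m⇒∣n (subst (p ∣_) expansion (m∣m*n (p ^ i)))
                        (∣-sum (s ∘ toℕ ∘ inject₁) p∣lower-terms)

  -- If all units were g-th roots of unity, powerSum g p would be ≡ p - 1, not ≡ 0.
  ¬all-units-^≡1 : ∀ {g} → 1 ≤ g → suc g < p → ¬ (∀ x → 1 ≤ x → x < p → x ^ g ≡ 1 mod p)
  ¬all-units-^≡1 {g@(suc _)} _ 1+g<p all-units = 1≢0-mod (begin
    1                 ≈⟨ +-cong-mod (∣⇒≡0-mod (p∣powerSum g 1+g<p)) (≡mod-refl {x = 1}) ⟨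
    powerSum g p + 1  ≈⟨ count p (>-nonZero⁻¹ p) ≤-refl ⟩
    p                 ≈⟨ ∣⇒≡0-mod ∣-refl ⟩
    0                 ∎)
    where
    open SetoidReasoning (≡mod-setoid {p})
    count : ∀ n → 1 ≤ n → n ≤ p → powerSum g n + 1 ≡ n mod p
    count 1        _ _   = ≡mod-refl
    count (2+ n)   _ n<p = begin
      powerSum g (2 + n) + 1                ≡⟨ cong (_+ 1) (powerSum-suc g (suc n)) ⟩
      powerSum g (1 + n) + suc n ^ g + 1    ≡⟨ +-assoc (powerSum g (1 + n)) (suc n ^ g) 1 ⟩
      powerSum g (1 + n) + (suc n ^ g + 1)  ≡⟨ cong (powerSum g (1 + n) +_) (+-comm (suc n ^ g) 1) ⟩
      powerSum g (1 + n) + (1 + suc n ^ g)  ≡⟨ +-assoc (powerSum g (1 + n)) 1 (suc n ^ g) ⟨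
      powerSum g (1 + n) + 1 + suc n ^ g    ≈⟨ +-cong-mod (count (suc n) z<s (<⇒≤ n<p)) (all-units (suc n) z<s n<p) ⟩
      suc n + 1                             ≡⟨ +-comm (suc n) 1 ⟩
      2 + n                                 ∎

  InS⇒p∤ : ∀ {e r} → 1 ≤ e → ¬ p ∣ r → ∀ {n} → InS p e r n → ¬ p ∣ n
  InS⇒p∤         _   p∤r base                     = p∤r
  InS⇒p∤ {suc e} 1≤e p∤r (root {n} _ s) p∣n       = InS⇒p∤ 1≤e p∤r s (∣m⇒∣m*n (n ^ e) p∣n)
  InS⇒p∤ {e}     1≤e p∤r (step {n} s)   p∣[n+p]ᵉ =
    InS⇒p∤ 1≤e p∤r s (∣m+n∣m⇒∣n (subst (p ∣_) (+-comm n p) (∣^⇒∣ e p∣[n+p]ᵉ)) ∣-refl)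

  ¬squareFree⇒maximal : ∀ {r} → 2 ≤ r → ¬ p ∣ r → ¬ SquareFree N →
                        ∃[ e ] (2 ≤ e × e ≤ p ∸ 2) × Maximal p e r
  ¬squareFree⇒maximal {r} 2≤r p∤r ¬sf with ¬squareFree⇒square∣ ¬sf
  ... | m , 2≤m , divides c N≡c*m² = e , (2≤e , e≤p∸2) , maximal
    where
    e : ℕ
    e = c * m
    2≤e : 2 ≤ e
    2≤e = *-mono-≤ {1} {c} (n≢0⇒n>0 λ c≡0 → ≢-nonZero⁻¹ N (trans N≡c*m² (cong (_* (m * m)) c≡0))) 2≤m
    e<N : e < N
    e<N = begin-strict
      e            <⟨ m<m+n e (<-trans z<s 2≤e) ⟩
      e + e        ≡⟨ solve 1 (λ e → e :+ e := e :* con 2) refl e ⟩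
      e * 2        ≤⟨ *-monoʳ-≤ e 2≤m ⟩
      e * m        ≡⟨ *-assoc c m m ⟩
      c * (m * m)  ≡⟨ N≡c*m² ⟨
      N            ∎
      where open ≤-Reasoning
    e≤p∸2 : e ≤ p ∸ 2
    e≤p∸2 = m+n≤o⇒m≤o∸n e (subst₂ _≤_ (+-comm 2 e) (suc-pred p) (s≤s e<N))
    e*e≡c*N : e * e ≡ c * N
    e*e≡c*N = trans (solve 2 (λ c m → (c :* m) :* (c :* m) := c :* (c :* (m :* m))) refl c m)
                    (cong (c *_) (sym N≡c*m²))
    e²-kills : ∀ {x} → ¬ p ∣ x → x ^ (e * e) ≡ 1 mod p
    e²-kills {x} p∤x = subst (λ k → x ^ k ≡ 1 mod p) (sym e*e≡c*N) (^-*-≡1-mod N c (fermat p∤x))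
    maximal : Maximal p e r
    maximal n = mk⇔ (λ s → InS⇒2≤ (<-trans z<s 2≤e) 2≤r s , InS⇒p∤ (<-trans z<s 2≤e) p∤r s)
                    (λ (2≤n , p∤n) → InS-complete 2≤e p∤r e²-kills 2≤n p∤n)

  squareFree⇒^gcd^e≡1⇒^gcd≡1 : ∀ {e} .{{_ : NonZero e}} → SquareFree N →
                               ∀ {n} → (n ^ gcd e N) ^ e ≡ 1 mod p → n ^ gcd e N ≡ 1 mod p
  squareFree⇒^gcd^e≡1⇒^gcd≡1 {e} sf {n} [nᵍ]ᵉ≡1 = by-cases (p ∣? n)
    where
    open SetoidReasoning (≡mod-setoid {p})
    g t : ℕ
    g = gcd e N
    t = quotient (gcd[m,n]∣n e N)
    instance
      g≢0 : NonZero g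
      g≢0 = gcd[e,N]≢0 e
    N≡t*g : N ≡ t * g
    N≡t*g = _∣_.equality (gcd[m,n]∣n e N)
    by-cases : Dec (p ∣ n) → n ^ g ≡ 1 mod p
    by-cases (yes p∣n) =
      contradiction (≡mod-trans (≡mod-sym [nᵍ]ᵉ≡1) (∣⇒≡0-mod (∣-^ e (∣-^ g p∣n)))) 1≢0-mod
    by-cases (no  p∤n) =
      ^≡1-coprime {y = n ^ g} {a = e} {b = t} (squareFree⇒coprime-cofactor sf N≡t*g) [nᵍ]ᵉ≡1 (begin
      (n ^ g) ^ t  ≡⟨ ^-*-assoc n g t ⟩
      n ^ (g * t)  ≡⟨ cong (n ^_) (trans (*-comm g t) (sym N≡t*g)) ⟩
      n ^ N        ≈⟨ fermat p∤n ⟩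
      1            ∎)

  squareFree⇒¬maximal : ∀ {e r} → 2 ≤ e → e ≤ p ∸ 2 → SquareFree N → ¬ Maximal p e r
  squareFree⇒¬maximal {e} {r} 2≤e e≤p∸2 sf maximal = ¬all-units-^≡1 (>-nonZero⁻¹ g) 1+g<p all-units
    where
    instance
      e≢0 : NonZero e
      e≢0 = >-nonZero (<-trans z<s 2≤e)
    g : ℕ
    g = gcd e N
    instance
      g≢0 : NonZero g
      g≢0 = gcd[e,N]≢0 e
    1+g<p : suc g < p
    1+g<p = ≤-<-trans (s≤s (∣⇒≤ (gcd[m,n]∣m e N)))
                      (subst (_≤ p) (+-comm e 2) (m≤o∸n⇒m+n≤o e 1<p e≤p∸2))
    Q : ℕ → Set
    Q n = n ^ g ≡ 1 mod p
    Q-pow : ∀ n → Q (n ^ e) ⇔ Q n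
    Q-pow n = mk⇔ (squareFree⇒^gcd^e≡1⇒^gcd≡1 sf ∘ ≡mod-trans (≡⇒≡mod (sym [nᵉ]ᵍ≡[nᵍ]ᵉ)))
                  (λ Qn → ≡mod-trans (≡⇒≡mod [nᵉ]ᵍ≡[nᵍ]ᵉ)
                                     (≡mod-trans (^-congˡ-mod e Qn) (≡⇒≡mod (^-zeroˡ e))))
      where [nᵉ]ᵍ≡[nᵍ]ᵉ = [m^n]^o≡[m^o]^n n e g
    Q-shift : ∀ n → Q (n + p) ⇔ Q n
    Q-shift n = mk⇔ (≡mod-trans (≡mod-sym (^-congˡ-mod g (+-mod-identityʳ n))))
                    (≡mod-trans (^-congˡ-mod g (+-mod-identityʳ n)))
    Q1 : Q 1
    Q1 = ≡⇒≡mod (^-zeroˡ g)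
    Q⇔Qr : ∀ {n} → 2 ≤ n → ¬ p ∣ n → Q n ⇔ Q r
    Q⇔Qr 2≤n p∤n = InS-invariant Q Q-pow Q-shift (Equivalence.from (maximal _) (2≤n , p∤n))
    Qr : Q r
    Qr = Equivalence.to (Q⇔Qr (s≤s (>-nonZero⁻¹ p)) p∤1+p) (Equivalence.from (Q-shift 1) Q1)
      where
      p∤1+p : ¬ p ∣ 1 + p
      p∤1+p p∣1+p = 0<x<p⇒p∤x z<s 1<p (∣m+n∣m⇒∣n (subst (p ∣_) (+-comm 1 p) p∣1+p) ∣-refl)
    all-units : ∀ x → 1 ≤ x → x < p → Q x
    all-units 1      _ _   = Q1
    all-units (2+ x) _ x<p = Equivalence.from (Q⇔Qr (s≤s (s≤s z≤n)) (0<x<p⇒p∤x z<s x<p)) Qr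

corollary22 : (p r : ℕ) → Prime p → r ≥ 2 → ¬ (p ∣ r) →
    (Σ ℕ (λ e → (2 ≤ e × e ≤ p ∸ 2) × Maximal p e r)) ⇔ (¬ SquareFree (p ∸ 1))
corollary22 p r p-prime 2≤r p∤r = mk⇔
  (λ (e , (2≤e , e≤p∸2) , maximal) sf → squareFree⇒¬maximal p-prime 2≤e e≤p∸2 sf maximal)
  (¬squareFree⇒maximal p-prime 2≤r p∤r)
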